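{- Let $x,n$ be integers with $2\leq x\leq n$, and let $H$ be a connected $k$-regular graph on $m\geq 2$ vertices. Then the edge corona $B_{x,n}\diamond H$ is antimagic.
   Context: All graphs are simple, finite and undirected. For a graph $G$ with $q$ edges, an antimagic labeling is a bijection $f:E(G)\to\{1,2,\dots,q\}$ such that the vertex sums $w(u)=\sum_{e\ni u} f(e)$ (sum over the edges incident to $u$) are pairwise distinct over all vertices $u\in V(G)$. A graph is antimagic if it admits an antimagic labeling. The bistar graph $B_{x,n}$ is obtained from two vertex-disjoint stars $K_{1,x}$ and $K_{1,n}$ by adding an edge between their centers. For graphs $G$ and $H$, the edge corona $G\diamond H$ is obtained by taking one copy of $G$ and $|E(G)|$ vertex-disjoint copies of $H$, one copy associated to each edge of $G$, and joining both end vertices of the $i$-th edge of $G$ to every vertex of the $i$-th copy of $H$. -}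

module Defs where

open import Data.Nat using (ℕ; zero; suc; _+_; _*_)
open import Data.Bool using (Bool; true; false; if_then_else_; _∨_)
open import Data.Fin using (Fin; zero; suc; _↑ˡ_; _↑ʳ_; splitAt; combine; remQuot; toℕ)
open import Data.Fin.Properties using (_≟_)
open import Data.Fin.Permutation using (Permutation′; _⟨$⟩ʳ_)
open import Data.List using (List; map; allFin)
open import Data.Nat.ListAction using (sum)
open import Data.Product using (_×_; _,_; proj₁; proj₂; ∃; ∃-syntax)
open import Data.Sum using (_⊎_; inj₁; inj₂)
open import Relation.Nullary using (¬_)
open import Relation.Nullary.Decidable using (⌊_⌋)
open import Relation.Binary.PropositionalEquality using (_≡_; _≢_)
open import Relation.Binary.Construct.Closure.ReflexiveTransitive using (Star)
open import Function.Definitions using (Injective)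

record Graph : Set where
  field
    V : ℕ
    E : ℕ
    ends : Fin E → Fin V × Fin V
open Graph public

SameEnds : {V : ℕ} → Fin V × Fin V → Fin V × Fin V → Set
SameEnds (a , b) (c , d) = (a ≡ c × b ≡ d) ⊎ (a ≡ d × b ≡ c)

Simple : Graph → Set
Simple G = (∀ e → proj₁ (ends G e) ≢ proj₂ (ends G e))
         × (∀ e e′ → SameEnds (ends G e) (ends G e′) → e ≡ e′)

incident : (G : Graph) → Fin (V G) → Fin (E G) → Bool
incident G v e = ⌊ proj₁ (ends G e) ≟ v ⌋ ∨ ⌊ proj₂ (ends G e) ≟ v ⌋

degree : (G : Graph) → Fin (V G) → ℕ
degree G v = sum (map (λ e → if incident G v e then 1 else 0) (allFin (E G)))

Regular : ℕ → Graph → Set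
Regular k G = ∀ v → degree G v ≡ k

Adj : (G : Graph) → Fin (V G) → Fin (V G) → Set
Adj G u v = ∃[ e ] SameEnds (ends G e) (u , v)

Connected : Graph → Set
Connected G = ∀ u v → Star (Adj G) u v

-- A labeling is a bijection E → {1,…,q}; encoded as a permutation σ of Fin q,
-- edge e getting label 1 + σ(e).
label : (G : Graph) → Permutation′ (E G) → Fin (E G) → ℕ
label G σ e = suc (toℕ (σ ⟨$⟩ʳ e))

weight : (G : Graph) → Permutation′ (E G) → Fin (V G) → ℕ
weight G σ v = sum (map (λ e → if incident G v e then label G σ e else 0) (allFin (E G)))

Antimagic : Graph → Set
Antimagic G = ∃[ σ ] Injective _≡_ _≡_ (weight G σ)

-- Bistar B_{x,n}: vertex 0 = centre of K_{1,x}, vertex 1 = centre of K_{1,n},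
-- then the x leaves of the first star, then the n leaves of the second.
-- Edge 0 joins the centres.
bistarEnds : (x n : ℕ) → Fin (suc (x + n)) → Fin (suc (suc (x + n))) × Fin (suc (suc (x + n)))
bistarEnds x n zero = zero , suc zero
bistarEnds x n (suc i) with splitAt x i
... | inj₁ a = zero , suc (suc (a ↑ˡ n))
... | inj₂ b = suc zero , suc (suc (x ↑ʳ b))

bistar : ℕ → ℕ → Graph
bistar x n = record { V = suc (suc (x + n)) ; E = suc (x + n) ; ends = bistarEnds x n }

-- Vertices: the V G vertices of G, then copy i (for each edge i of G)
-- of the vertices of H. Edges: the edges of G, then for each edge i of G a block of
-- E H + V H + V H edges: the copy of H's edges, then the first end of edge i joined to
-- each vertex of copy i, then the second end of edge i joined to each vertex of copy i.
coronaEnds : (G H : Graph) → Fin (E G + E G * (E H + (V H + V H)))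
           → Fin (V G + E G * V H) × Fin (V G + E G * V H)
coronaEnds G H e with splitAt (E G) e
... | inj₁ g = (proj₁ (ends G g) ↑ˡ (E G * V H)) , (proj₂ (ends G g) ↑ˡ (E G * V H))
... | inj₂ r with remQuot (E H + (V H + V H)) r
...   | (i , t) with splitAt (E H) t
...     | inj₁ h = copy (proj₁ (ends H h)) , copy (proj₂ (ends H h))
  where copy : Fin (V H) → Fin (V G + E G * V H)
        copy w = V G ↑ʳ combine i w
...     | inj₂ s with splitAt (V H) s
...       | inj₁ w = (proj₁ (ends G i) ↑ˡ (E G * V H)) , (V G ↑ʳ combine i w)
...       | inj₂ w = (proj₂ (ends G i) ↑ˡ (E G * V H)) , (V G ↑ʳ combine i w)

_◇_ : Graph → Graph → Graph
G ◇ H = record { V = V G + E G * V H ; E = E G + E G * (E H + (V H + V H)) ; ends = coronaEnds G H }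

-- The edges of the copies of H get the smallest labels, copy by copy; then come the spokes from
-- the first ends of the edges of B_{x,n}, then those from the second ends, both copy by copy and,
-- inside a copy, in the order of the sums Hsum w of the H-labels at w; the edges of B_{x,n} get
-- the largest labels. If H is k-regular, vertex w of the i-th copy then has weight
-- i·D + (Hsum w + 2·rank w) + C with Hsum w + 2·rank w < D = k·|E(H)| + 2·|V(H)|, which separates
-- the copy vertices. As k < |V(H)| (H is simple), every copy vertex is lighter than every leaf of
-- B_{x,n}. Leaf weights increase with the index, and as |V(H)| ≤ |E(H)| + 1 (H is connected) and
-- x ≥ 2 the heaviest leaf is lighter than the centre of K_{1,x}, which is lighter than the centre
-- of K_{1,n} because x ≤ n.

module Submission where

open import Defs
import Data.Nat as ℕ
open import Data.Nat using (ℕ; zero; suc; _+_; _*_; _∸_; _≤_; _<_; _≤?_; _<?_; z≤n; s≤s)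
open import Data.Nat.Properties hiding (_≟_)
open import Data.Nat.ListAction using (sum)
open import Data.Nat.Tactic.RingSolver using (solve-∀; solve)
open import Algebra.Properties.Semiring.Sum +-*-semiring
  using (sum-syntax; ∑-distrib-+; ∑-comm; sum-cong-≗; *-distribˡ-sum)
open import Data.Bool using (Bool; true; false; if_then_else_; _∨_; _∧_)
open import Data.Bool.Properties using (∨-zeroʳ; ∨-identityʳ; ∧-distribˡ-∨; ∧-conicalˡ; ∧-conicalʳ)
open import Data.Fin as Fin using (Fin; zero; suc; _↑ˡ_; _↑ʳ_; splitAt; combine; quotRem; toℕ; fromℕ<)
open import Data.Fin.Properties as Finₚ
  using (_≟_; toℕ-↑ˡ; toℕ-↑ʳ; toℕ-combine; toℕ-fromℕ<; toℕ-cast; toℕ<n; toℕ-injective; +↔⊎; *↔×)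
open import Function.Bundles using (_↔_; Inverse; mk↔ₛ′)
open import Function.Construct.Identity using (↔-id)
open import Function.Construct.Composition using (_↔-∘_)
open import Function.Construct.Symmetry using (↔-sym)
open import Data.Sum.Function.Propositional using (_⊎-↔_)
open import Data.Product.Function.NonDependent.Propositional using (_×-↔_)
open import Data.Fin.Permutation
  using (Permutation′; _⟨$⟩ʳ_; _⟨$⟩ˡ_; permutation; inverseˡ; inverseʳ; cast-id)
open import Data.List using (map; allFin; tabulate; _∷_; [])
open import Data.List.Properties using (map-tabulate)
open import Data.Product using (_×_; _,_; proj₁; proj₂; ∃-syntax)
open import Data.Sum using (_⊎_; inj₁; inj₂)
open import Data.Empty using (⊥-elim)
open import Relation.Nullary using (yes; no; contradiction)
open import Relation.Nullary.Decidable using (⌊_⌋)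
open import Relation.Binary.PropositionalEquality
  using (_≡_; _≢_; refl; sym; trans; cong; cong₂; subst; module ≡-Reasoning)
open import Relation.Binary.Definitions using (tri<; tri≈; tri>)
open import Function.Definitions using (Injective)
open import Function using (_∘′_; _$_)
open import Relation.Binary.Construct.Closure.ReflexiveTransitive using (Star; ε; _◅_)

private
  variable
    n : ℕ

≟-refl : (a : Fin n) → ⌊ a ≟ a ⌋ ≡ true
≟-refl a with a ≟ a
... | yes _   = refl
... | no a≢a  = contradiction refl a≢a

≟-≢ : {a b : Fin n} → a ≢ b → ⌊ a ≟ b ⌋ ≡ false
≟-≢ {a = a} {b} a≢b with a ≟ b
... | yes a≡b = contradiction a≡b a≢b
... | no _    = refl

≟-true : {a b : Fin n} → ⌊ a ≟ b ⌋ ≡ true → a ≡ b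
≟-true {a = a} {b} eq with a ≟ b
... | yes a≡b = a≡b

≟-injective : ∀ {m n} (f : Fin m → Fin n) → Injective _≡_ _≡_ f → ∀ a b → ⌊ f a ≟ f b ⌋ ≡ ⌊ a ≟ b ⌋
≟-injective f f-inj a b with a ≟ b
... | yes refl = ≟-refl (f a)
... | no a≢b   = ≟-≢ (λ eq → a≢b (f-inj eq))

-- Finite sums

sum-map-allFin : (f : Fin n → ℕ) → sum (map f (allFin n)) ≡ ∑[ i < n ] f i
sum-map-allFin {n} f = trans (cong sum (map-tabulate (λ i → i) f)) (go n f)
  where
  go : ∀ n (f : Fin n → ℕ) → sum (tabulate f) ≡ ∑[ i < n ] f i
  go zero    f = refl
  go (suc n) f = cong (f zero +_) (go n (λ i → f (suc i)))

∑-const : ∀ n c → ∑[ i < n ] c ≡ n * c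
∑-const zero    c = refl
∑-const (suc n) c = cong (c +_) (∑-const n c)

∑-0 : ∀ n → ∑[ i < n ] 0 ≡ 0
∑-0 n = trans (∑-const n 0) (*-zeroʳ n)

∑-≡0 : (f : Fin n → ℕ) → (∀ i → f i ≡ 0) → ∑[ i < n ] f i ≡ 0
∑-≡0 {n} f f≡0 = trans (sum-cong-≗ f≡0) (∑-0 n)

∑-if : ∀ b (f : Fin n → ℕ) → ∑[ i < n ] (if b then f i else 0) ≡ (if b then ∑[ i < n ] f i else 0)
∑-if {n} true  f = refl
∑-if {n} false f = ∑-0 n

∑-↑ : ∀ a b (f : Fin (a + b) → ℕ) →
      ∑[ i < a + b ] f i ≡ ∑[ i < a ] f (i ↑ˡ b) + ∑[ j < b ] f (a ↑ʳ j)
∑-↑ zero    b f = refl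
∑-↑ (suc a) b f = trans (cong (f zero +_) (∑-↑ a b (λ i → f (suc i))))
                       (sym (+-assoc (f zero) _ _))

∑-combine : ∀ a b (f : Fin (a * b) → ℕ) →
            ∑[ r < a * b ] f r ≡ ∑[ i < a ] ∑[ j < b ] f (combine i j)
∑-combine zero    b f = refl
∑-combine (suc a) b f = trans (∑-↑ b (a * b) f)
                              (cong (∑[ j < b ] f (j ↑ˡ (a * b)) +_) (∑-combine a b (λ r → f (b ↑ʳ r))))

∑-mono-≤ : {f g : Fin n → ℕ} → (∀ i → f i ≤ g i) → ∑[ i < n ] f i ≤ ∑[ i < n ] g i
∑-mono-≤ {zero}  f≤g = z≤n
∑-mono-≤ {suc n} f≤g = +-mono-≤ (f≤g zero) (∑-mono-≤ (λ i → f≤g (suc i)))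

∑-mono-< : {f g : Fin n → ℕ} → (∀ i → f i ≤ g i) → ∀ i₀ → f i₀ < g i₀ →
           ∑[ i < n ] f i < ∑[ i < n ] g i
∑-mono-< f≤g zero     f<g = +-mono-<-≤ f<g (∑-mono-≤ (λ i → f≤g (suc i)))
∑-mono-< f≤g (suc i₀) f<g = +-mono-≤-< (f≤g zero) (∑-mono-< (λ i → f≤g (suc i)) i₀ f<g)

∑-single : (f : Fin n → ℕ) (i₀ : Fin n) → (∀ i → i ≢ i₀ → f i ≡ 0) → ∑[ i < n ] f i ≡ f i₀
∑-single {suc n} f zero     f≡0 =
  trans (cong (f zero +_) (∑-≡0 _ (λ i → f≡0 (suc i) (λ ())))) (+-identityʳ _)
∑-single {suc n} f (suc i₀) f≡0 =
  trans (cong (_+ ∑[ i < n ] f (suc i)) (f≡0 zero (λ ())))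
        (∑-single (λ i → f (suc i)) i₀ (λ i i≢i₀ → f≡0 (suc i) (λ eq → i≢i₀ (Finₚ.suc-injective eq))))

≤-∑ : (f : Fin n → ℕ) (i : Fin n) → f i ≤ ∑[ j < n ] f j
≤-∑ f zero    = m≤m+n (f zero) _
≤-∑ f (suc i) = ≤-trans (≤-∑ (λ j → f (suc j)) i) (m≤n+m _ (f zero))

+-≤-∑ : (f : Fin n → ℕ) (i j : Fin n) → i ≢ j → f i + f j ≤ ∑[ l < n ] f l
+-≤-∑ f zero    zero    i≢j = contradiction refl i≢j
+-≤-∑ f zero    (suc j) i≢j = +-monoʳ-≤ (f zero) (≤-∑ (λ l → f (suc l)) j)
+-≤-∑ f (suc i) zero    i≢j = ≤-trans (≤-reflexive (+-comm (f (suc i)) (f zero)))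
                                      (+-monoʳ-≤ (f zero) (≤-∑ (λ l → f (suc l)) i))
+-≤-∑ f (suc i) (suc j) i≢j = ≤-trans (+-≤-∑ (λ l → f (suc l)) i j (λ eq → i≢j (cong suc eq)))
                                      (m≤n+m _ (f zero))

χ : Bool → ℕ
χ b = if b then 1 else 0

∑-if-const : (P : Fin n → Bool) (c : ℕ) → ∑[ i < n ] (if P i then c else 0) ≡ c * ∑[ i < n ] χ (P i)
∑-if-const P c = trans (sum-cong-≗ (λ i → if-const (P i))) (sym (*-distribˡ-sum c (λ i → χ (P i))))
  where
  if-const : ∀ b → (if b then c else 0) ≡ c * χ b
  if-const true  = sym (*-identityʳ c)
  if-const false = sym (*-zeroʳ c)

∑-if-+ : (P : Fin n → Bool) (c : ℕ) (f : Fin n → ℕ) →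
         ∑[ i < n ] (if P i then c + f i else 0) ≡ c * ∑[ i < n ] χ (P i) + ∑[ i < n ] (if P i then f i else 0)
∑-if-+ {n} P c f = begin
  ∑[ i < n ] (if P i then c + f i else 0)                                ≡⟨ sum-cong-≗ (λ i → if-+ (P i) (f i)) ⟩
  ∑[ i < n ] ((if P i then c else 0) + (if P i then f i else 0))         ≡⟨ ∑-distrib-+ (λ i → if P i then c else 0) _ ⟩
  ∑[ i < n ] (if P i then c else 0) + ∑[ i < n ] (if P i then f i else 0) ≡⟨ cong (_+ _) (∑-if-const P c) ⟩
  c * ∑[ i < n ] χ (P i) + ∑[ i < n ] (if P i then f i else 0)          ∎
  where
  open ≡-Reasoning
  if-+ : ∀ b d → (if b then c + d else 0) ≡ (if b then c else 0) + (if b then d else 0)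
  if-+ true  d = refl
  if-+ false d = refl

∑χ-atMostOne : (P : Fin n → Bool) → (∀ i j → P i ≡ true → P j ≡ true → i ≡ j) →
               ∑[ i < n ] χ (P i) ≤ 1
∑χ-atMostOne {zero}  P unique = z≤n
∑χ-atMostOne {suc n} P unique with P zero in P₀
... | true  = ≤-reflexive (cong suc (∑-≡0 _ rest≡0))
  where
  rest≡0 : ∀ i → χ (P (suc i)) ≡ 0
  rest≡0 i with P (suc i) in Pᵢ
  ... | true  with () ← unique zero (suc i) P₀ Pᵢ
  ... | false = refl
... | false = ∑χ-atMostOne (λ i → P (suc i)) (λ i j Pi Pj → Finₚ.suc-injective (unique (suc i) (suc j) Pi Pj))

∑-if-≟ : (f : Fin n → ℕ) (v : Fin n) → ∑[ w < n ] (if ⌊ w ≟ v ⌋ then f w else 0) ≡ f v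
∑-if-≟ f v = trans (∑-single _ v (λ w w≢v → cong (λ b → if b then f w else 0) (≟-≢ w≢v)))
                   (cong (λ b → if b then f v else 0) (≟-refl v))

∑χ-≟ : (a : Fin n) → ∑[ v < n ] χ ⌊ a ≟ v ⌋ ≡ 1
∑χ-≟ a = trans (∑-single _ a (λ v v≢a → cong χ (≟-≢ (λ eq → v≢a (sym eq))))) (cong χ (≟-refl a))

-- Ranks

injective⇒surjective : (f : Fin n → Fin n) → Injective _≡_ _≡_ f → ∀ y → ∃[ x ] f x ≡ y
injective⇒surjective {suc n} f f-inj y with Finₚ.any? (λ x → f x ≟ y)
... | yes hit = hit
... | no miss = ⊥-elim (<-irrefl refl (Finₚ.injective⇒≤ g-inj))
  where
  -- Since y is missed, punching it out of the codomain keeps f injective, into a smaller set.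
  y≢f : ∀ x → y ≢ f x
  y≢f x eq = miss (x , sym eq)
  g : Fin (suc n) → Fin n
  g x = Fin.punchOut (y≢f x)
  g-inj : Injective _≡_ _≡_ g
  g-inj eq = f-inj (Finₚ.punchOut-injective (y≢f _) (y≢f _) eq)

injective⇒permutation : (f : Fin n → Fin n) → Injective _≡_ _≡_ f → Permutation′ n
injective⇒permutation f f-inj =
  permutation f (λ y → proj₁ (onto y)) (λ y → proj₂ (onto y)) (λ x → f-inj (proj₂ (onto (f x))))
  where
  onto : ∀ y → ∃[ x ] f x ≡ y
  onto = injective⇒surjective f f-inj

*+-<-lex : ∀ d {q q′} r r′ → q < q′ → r < d → q * d + r < q′ * d + r′
*+-<-lex d {q} {q′} r r′ q<q′ r<d = begin-strict
  q * d + r    <⟨ +-monoʳ-< (q * d) r<d ⟩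
  q * d + d    ≡⟨ +-comm (q * d) d ⟩
  suc q * d    ≤⟨ *-monoˡ-≤ d q<q′ ⟩
  q′ * d       ≤⟨ m≤m+n (q′ * d) r′ ⟩
  q′ * d + r′  ∎
  where open ≤-Reasoning

*+-injective : ∀ d q q′ {r r′} → r < d → r′ < d → q * d + r ≡ q′ * d + r′ → q ≡ q′ × r ≡ r′
*+-injective d q q′ {r} {r′} r<d r′<d eq with <-cmp q q′
... | tri< q<q′ _ _ = contradiction eq (<⇒≢ (*+-<-lex d r r′ q<q′ r<d))
... | tri> _ _ q>q′ = contradiction eq (>⇒≢ (*+-<-lex d r′ r q>q′ r′<d))
... | tri≈ _ refl _ = refl , +-cancelˡ-≡ (q * d) r r′ eq

strictlyFollows⇒injective : {A : Set} (key g : A → ℕ) → Injective _≡_ _≡_ key →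
                            (∀ {a b} → key a < key b → g a < g b) → Injective _≡_ _≡_ g
strictlyFollows⇒injective key g key-inj follows {a} {b} ga≡gb with <-cmp (key a) (key b)
... | tri< ka<kb _ _ = contradiction ga≡gb (<⇒≢ (follows ka<kb))
... | tri≈ _ ka≡kb _ = key-inj ka≡kb
... | tri> _ _ ka>kb = contradiction ga≡gb (>⇒≢ (follows ka>kb))

module Rank (key : Fin n → ℕ) where

  rank : Fin n → ℕ
  rank w = ∑[ v < n ] χ ⌊ key v <? key w ⌋

  rank< : ∀ w → rank w < n
  rank< w = begin-strict
    rank w             <⟨ ∑-mono-< (λ v → χ≤1 ⌊ key v <? key w ⌋) w (self w) ⟩
    ∑[ v < n ] 1       ≡⟨ trans (∑-const n 1) (*-identityʳ n) ⟩
    n                  ∎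
    where
    open ≤-Reasoning
    χ≤1 : ∀ b → χ b ≤ 1
    χ≤1 true  = ≤-refl
    χ≤1 false = z≤n
    self : ∀ w → χ ⌊ key w <? key w ⌋ < 1
    self w with key w <? key w
    ... | yes kw<kw = contradiction kw<kw (<-irrefl refl)
    ... | no _      = s≤s z≤n

  rank-mono-< : ∀ {a b} → key a < key b → rank a < rank b
  rank-mono-< {a} {b} ka<kb = ∑-mono-< step a reach
    where
    step : ∀ v → χ ⌊ key v <? key a ⌋ ≤ χ ⌊ key v <? key b ⌋
    step v with key v <? key a | key v <? key b
    ... | yes _     | yes _     = ≤-refl
    ... | no _      | _         = z≤n
    ... | yes kv<ka | no kv≮kb  = contradiction (<-trans kv<ka ka<kb) kv≮kb
    reach : χ ⌊ key a <? key a ⌋ < χ ⌊ key a <? key b ⌋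
    reach with key a <? key a | key a <? key b
    ... | yes ka<ka | _        = contradiction ka<ka (<-irrefl refl)
    ... | no _      | yes _    = s≤s z≤n
    ... | no _      | no ka≮kb = contradiction ka<kb ka≮kb

module Ranking (h : Fin n → ℕ) where

  key : Fin n → ℕ
  key w = h w * n + toℕ w

  open Rank key public

  key-injective : Injective _≡_ _≡_ key
  key-injective {a} {b} eq = toℕ-injective (proj₂ (*+-injective n (h a) (h b) (toℕ<n a) (toℕ<n b) eq))

  key<⇒h≤ : ∀ {a b} → key a < key b → h a ≤ h b
  key<⇒h≤ {a} {b} ka<kb with ≤-<-connex (h a) (h b)
  ... | inj₁ ha≤hb = ha≤hb
  ... | inj₂ hb<ha = contradiction ka<kb (<-asym (*+-<-lex n (toℕ b) (toℕ a) hb<ha (toℕ<n b)))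

  rank-injective : Injective _≡_ _≡_ rank
  rank-injective = strictlyFollows⇒injective key rank key-injective rank-mono-<

  ranking : Permutation′ n
  ranking = injective⇒permutation (λ w → fromℕ< (rank< w))
              (λ eq → rank-injective (trans (sym (toℕ-fromℕ< _)) (trans (cong toℕ eq) (toℕ-fromℕ< _))))

  toℕ-ranking : ∀ w → toℕ (ranking ⟨$⟩ʳ w) ≡ rank w
  toℕ-ranking w = toℕ-fromℕ< (rank< w)

  +2*rank-injective : Injective _≡_ _≡_ (λ w → h w + 2 * rank w)
  +2*rank-injective = strictlyFollows⇒injective key _ key-injective
    (λ ka<kb → +-mono-≤-< (key<⇒h≤ ka<kb) (*-monoʳ-< 2 (rank-mono-< ka<kb)))

-- Degrees

SameEnds-common : ∀ {x y : Fin n × Fin n} {u v} → SameEnds x (u , v) → SameEnds y (u , v) → SameEnds x y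
SameEnds-common (inj₁ (refl , refl)) (inj₁ (refl , refl)) = inj₁ (refl , refl)
SameEnds-common (inj₁ (refl , refl)) (inj₂ (refl , refl)) = inj₂ (refl , refl)
SameEnds-common (inj₂ (refl , refl)) (inj₁ (refl , refl)) = inj₂ (refl , refl)
SameEnds-common (inj₂ (refl , refl)) (inj₂ (refl , refl)) = inj₁ (refl , refl)

SameEnds-unique : ∀ {x : Fin n × Fin n} {u v w} → SameEnds x (u , v) → SameEnds x (u , w) → v ≡ w
SameEnds-unique (inj₁ (refl , refl)) (inj₁ (_ , refl))    = refl
SameEnds-unique (inj₁ (refl , refl)) (inj₂ (refl , refl)) = refl
SameEnds-unique (inj₂ (refl , refl)) (inj₁ (refl , refl)) = refl
SameEnds-unique (inj₂ (refl , refl)) (inj₂ (refl , _))    = refl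

module Degree (G : Graph) where

  degree-∑ : ∀ v → degree G v ≡ ∑[ e < E G ] χ (incident G v e)
  degree-∑ v = sum-map-allFin (λ e → χ (incident G v e))

  SameEnds⇒incident : ∀ {u v} e → SameEnds (ends G e) (u , v) → incident G u e ≡ true
  SameEnds⇒incident {u} e (inj₁ (refl , _)) rewrite ≟-refl u = refl
  SameEnds⇒incident {u} e (inj₂ (_ , refl)) rewrite ≟-refl u = ∨-zeroʳ _

  incident⇒degree≥1 : ∀ {v} e → incident G v e ≡ true → 1 ≤ degree G v
  incident⇒degree≥1 {v} e inc = begin
    1                             ≡⟨ cong χ inc ⟨
    χ (incident G v e)            ≤⟨ ≤-∑ (λ e → χ (incident G v e)) e ⟩
    ∑[ e < E G ] χ (incident G v e) ≡⟨ degree-∑ v ⟨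
    degree G v                    ∎
    where open ≤-Reasoning

  handshake : ∑[ v < V G ] degree G v ≤ 2 * E G
  handshake = begin
    ∑[ v < V G ] degree G v                            ≡⟨ sum-cong-≗ degree-∑ ⟩
    ∑[ v < V G ] ∑[ e < E G ] χ (incident G v e)       ≡⟨ ∑-comm (λ v e → χ (incident G v e)) ⟩
    ∑[ e < E G ] ∑[ v < V G ] χ (incident G v e)       ≤⟨ ∑-mono-≤ (λ e → ∑-mono-≤ (λ v → χ-∨ ⌊ e₁ e ≟ v ⌋ ⌊ e₂ e ≟ v ⌋)) ⟩
    ∑[ e < E G ] ∑[ v < V G ] (χ ⌊ e₁ e ≟ v ⌋ + χ ⌊ e₂ e ≟ v ⌋) ≡⟨ sum-cong-≗ two-ends ⟩
    ∑[ e < E G ] 2                                     ≡⟨ trans (∑-const (E G) 2) (*-comm (E G) 2) ⟩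
    2 * E G                                            ∎
    where
    open ≤-Reasoning
    e₁ e₂ : Fin (E G) → Fin (V G)
    e₁ e = proj₁ (ends G e)
    e₂ e = proj₂ (ends G e)
    χ-∨ : ∀ b c → χ (b ∨ c) ≤ χ b + χ c
    χ-∨ true  c = s≤s z≤n
    χ-∨ false c = ≤-refl
    two-ends : ∀ e → ∑[ v < V G ] (χ ⌊ e₁ e ≟ v ⌋ + χ ⌊ e₂ e ≟ v ⌋) ≡ 2
    two-ends e = trans (∑-distrib-+ (λ v → χ ⌊ e₁ e ≟ v ⌋) (λ v → χ ⌊ e₂ e ≟ v ⌋))
                       (cong₂ _+_ (∑χ-≟ (e₁ e)) (∑χ-≟ (e₂ e)))

  otherEnd : Fin (V G) → Fin (E G) → Fin (V G)
  otherEnd v e = if ⌊ proj₁ (ends G e) ≟ v ⌋ then proj₂ (ends G e) else proj₁ (ends G e)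

  joins : Fin (V G) → Fin (V G) → Fin (E G) → Bool
  joins v u e = incident G v e ∧ ⌊ otherEnd v e ≟ u ⌋

  joins⇒SameEnds : ∀ v u e → joins v u e ≡ true → SameEnds (ends G e) (v , u)
  joins⇒SameEnds v u e joined
    with inc ← ∧-conicalˡ (incident G v e) _ joined | other ← ∧-conicalʳ (incident G v e) _ joined
    with proj₁ (ends G e) ≟ v
  ... | yes e₁≡v = inj₁ (e₁≡v , ≟-true other)
  ... | no _     = inj₂ (≟-true other , ≟-true inc)

  ∑χ-joins : ∀ v e → ∑[ u < V G ] χ (joins v u e) ≡ χ (incident G v e)
  ∑χ-joins v e with incident G v e
  ... | true  = ∑χ-≟ (otherEnd v e)
  ... | false = ∑-≡0 (λ u → χ (false ∧ ⌊ otherEnd v e ≟ u ⌋)) (λ _ → refl)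

  -- Counting each incident edge at its other end: in a simple graph each vertex u ≠ v
  -- is counted at most once, and v itself never.
  simple⇒degree< : Simple G → ∀ v → degree G v < V G
  simple⇒degree< (loopless , noMultiEdge) v = begin-strict
    degree G v                                          ≡⟨ degree-∑ v ⟩
    ∑[ e < E G ] χ (incident G v e)                     ≡⟨ sum-cong-≗ (∑χ-joins v) ⟨
    ∑[ e < E G ] ∑[ u < V G ] χ (joins v u e)           ≡⟨ ∑-comm (λ e u → χ (joins v u e)) ⟩
    ∑[ u < V G ] ∑[ e < E G ] χ (joins v u e)           <⟨ ∑-mono-< atMostOne v noLoop ⟩
    ∑[ u < V G ] 1                                      ≡⟨ trans (∑-const (V G) 1) (*-identityʳ _) ⟩
    V G                                                 ∎
    where
    open ≤-Reasoning
    atMostOne : ∀ u → ∑[ e < E G ] χ (joins v u e) ≤ 1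
    atMostOne u = ∑χ-atMostOne (joins v u) (λ e e′ je je′ →
      noMultiEdge e e′ (SameEnds-common (joins⇒SameEnds v u e je) (joins⇒SameEnds v u e′ je′)))
    noLoop : ∑[ e < E G ] χ (joins v v e) < 1
    noLoop = subst (_< 1) (sym (∑-≡0 (λ e → χ (joins v v e)) notLoop)) (s≤s z≤n)
      where
      notLoop : ∀ e → χ (joins v v e) ≡ 0
      notLoop e with joins v v e in je
      ... | false = refl
      ... | true with joins⇒SameEnds v v e je
      ...   | inj₁ (e₁≡v , e₂≡v) = contradiction (trans e₁≡v (sym e₂≡v)) (loopless e)
      ...   | inj₂ (e₁≡v , e₂≡v) = contradiction (trans e₁≡v (sym e₂≡v)) (loopless e)

  Adj-sym : ∀ {u v} → Adj G u v → Adj G v u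
  Adj-sym (e , inj₁ (e₁≡u , e₂≡v)) = e , inj₂ (e₁≡u , e₂≡v)
  Adj-sym (e , inj₂ (e₁≡v , e₂≡u)) = e , inj₁ (e₁≡v , e₂≡u)

  Star⇒incident : ∀ {u v} → Star (Adj G) u v → u ≢ v → ∃[ e ] incident G u e ≡ true
  Star⇒incident ε                u≢v = contradiction refl u≢v
  Star⇒incident ((e , same) ◅ _) _   = e , SameEnds⇒incident e same

  degree≤1⇒Adj-unique : ∀ {u v w} → degree G u ≤ 1 → Adj G u v → Adj G u w → v ≡ w
  degree≤1⇒Adj-unique {u} deg≤1 (e , same) (e′ , same′) with e ≟ e′
  ... | yes refl = SameEnds-unique same same′
  ... | no e≢e′  = contradiction (≤-trans twoEdges deg≤1) (<-irrefl refl)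
    where
    twoEdges : 2 ≤ degree G u
    twoEdges = begin
      2                                                       ≡⟨ cong₂ (λ b c → χ b + χ c)
                                                                   (SameEnds⇒incident e same) (SameEnds⇒incident e′ same′) ⟨
      χ (incident G u e) + χ (incident G u e′)                ≤⟨ +-≤-∑ (λ e → χ (incident G u e)) e e′ e≢e′ ⟩
      ∑[ e < E G ] χ (incident G u e)                         ≡⟨ degree-∑ u ⟨
      degree G u                                              ∎
      where open ≤-Reasoning

  1-regular-walk : Regular 1 G → ∀ {u v} → Star (Adj G) u v → v ≡ u ⊎ Adj G u v
  1-regular-walk reg ε = inj₁ refl
  1-regular-walk reg (u∼w ◅ walk) with 1-regular-walk reg walk
  ... | inj₁ refl = inj₂ u∼w
  ... | inj₂ w∼v  = inj₁ (degree≤1⇒Adj-unique (≤-reflexive (reg _)) w∼v (Adj-sym u∼w))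

module RegularGraph {k} (G : Graph) (connected : Connected G) (regular : Regular k G) (2≤V : 2 ≤ V G) where
  open Degree G

  v₀ v₁ : Fin (V G)
  v₀ = fromℕ< (≤-trans (s≤s z≤n) 2≤V)
  v₁ = fromℕ< 2≤V

  v₀≢v₁ : v₀ ≢ v₁
  v₀≢v₁ eq with () ← Finₚ.fromℕ<-injective 0 1 _ _ eq

  1≤k : 1 ≤ k
  1≤k with e , inc ← Star⇒incident (connected v₀ v₁) v₀≢v₁ =
    subst (1 ≤_) (regular v₀) (incident⇒degree≥1 e inc)

  1≤E : 1 ≤ E G
  1≤E with e , _ ← Star⇒incident (connected v₀ v₁) v₀≢v₁ = ≤-trans (s≤s z≤n) (toℕ<n e)

  1-regular⇒V≤2 : Regular 1 G → V G ≤ 2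
  1-regular⇒V≤2 regular₁ with V G ≤? 2
  ... | yes V≤2 = V≤2
  ... | no V≰2  =
    contradiction (degree≤1⇒Adj-unique (≤-reflexive (regular₁ v₀)) (v₀∼ v₁ v₀≢v₁) (v₀∼ v₂ v₀≢v₂)) v₁≢v₂
    where
    v₂ : Fin (V G)
    v₂ = fromℕ< (≰⇒> V≰2)
    v₀≢v₂ : v₀ ≢ v₂
    v₀≢v₂ eq with () ← Finₚ.fromℕ<-injective 0 2 _ _ eq
    v₁≢v₂ : v₁ ≢ v₂
    v₁≢v₂ eq with () ← Finₚ.fromℕ<-injective 1 2 _ _ eq
    v₀∼ : ∀ v → v₀ ≢ v → Adj G v₀ v
    v₀∼ v v₀≢v with 1-regular-walk regular₁ (connected v₀ v)
    ... | inj₁ v≡v₀ = contradiction (sym v≡v₀) v₀≢v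
    ... | inj₂ v₀∼v = v₀∼v

  -- For k = 1 the graph is a single edge; for k ≥ 2 use the handshake bound 2·V ≤ k·V ≤ 2·E.
  V≤1+E : V G ≤ suc (E G)
  V≤1+E with k ℕ.≟ 1
  ... | yes refl = ≤-trans (1-regular⇒V≤2 regular) (s≤s 1≤E)
  ... | no k≢1   = ≤-trans (*-cancelˡ-≤ 2 2V≤2E) (n≤1+n (E G))
    where
    2V≤2E : 2 * V G ≤ 2 * E G
    2V≤2E = begin
      2 * V G                    ≤⟨ *-monoˡ-≤ (V G) (≤∧≢⇒< 1≤k (k≢1 ∘′ sym)) ⟩
      k * V G                    ≡⟨ *-comm k (V G) ⟩
      V G * k                    ≡⟨ ∑-const (V G) k ⟨
      ∑[ v < V G ] k             ≡⟨ sum-cong-≗ regular ⟨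
      ∑[ v < V G ] degree G v    ≤⟨ handshake ⟩
      2 * E G                    ∎
      where open ≤-Reasoning

  k<V : Simple G → k < V G
  k<V simple = subst (_< V G) (regular v₀) (simple⇒degree< simple v₀)

-- Edge coronas

pattern base g       = inj₁ g
pattern inner i h    = inj₂ (i , inj₁ h)
pattern spoke₁ i w   = inj₂ (i , inj₂ (inj₁ w))
pattern spoke₂ i w   = inj₂ (i , inj₂ (inj₂ w))
pattern outer u      = inj₁ u
pattern copy i w     = inj₂ (i , w)

module Corona (G H : Graph) where

  -- An edge of G ◇ H is an edge g of G, an edge h of the i-th copy of H, or a spoke from the
  -- first (spoke₁) or second (spoke₂) end of the i-th edge of G to a vertex w of the i-th copy.
  CoronaEdge : Set
  CoronaEdge = Fin (E G) ⊎ Fin (E G) × (Fin (E H) ⊎ (Fin (V H) ⊎ Fin (V H)))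

  CoronaVertex : Set
  CoronaVertex = Fin (V G) ⊎ Fin (E G) × Fin (V H)

  edgeIndex : Fin (E (G ◇ H)) ↔ CoronaEdge
  edgeIndex =
    (↔-id _ ⊎-↔ ((↔-id _ ×-↔ (↔-id _ ⊎-↔ +↔⊎)) ↔-∘ ((↔-id _ ×-↔ +↔⊎) ↔-∘ *↔×))) ↔-∘ +↔⊎

  vertexIndex : Fin (V (G ◇ H)) ↔ CoronaVertex
  vertexIndex = (↔-id _ ⊎-↔ *↔×) ↔-∘ +↔⊎

  open Inverse edgeIndex using () renaming (from to ⟦_⟧ᵉ; to to decodeEdge; strictlyInverseˡ to decode-⟦⟧ᵉ) public
  open Inverse vertexIndex using () renaming (from to ⟦_⟧ᵛ; to to decodeVertex; strictlyInverseʳ to ⟦⟧ᵛ-decode) public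

  outerVertex : Fin (V G) → Fin (V (G ◇ H))
  outerVertex u = ⟦ outer u ⟧ᵛ

  copyVertex : Fin (E G) → Fin (V H) → Fin (V (G ◇ H))
  copyVertex i w = ⟦ copy i w ⟧ᵛ

  edgeEnds : CoronaEdge → Fin (V (G ◇ H)) × Fin (V (G ◇ H))
  edgeEnds (base g)     = outerVertex (proj₁ (ends G g)) , outerVertex (proj₂ (ends G g))
  edgeEnds (inner i h)  = copyVertex i (proj₁ (ends H h)) , copyVertex i (proj₂ (ends H h))
  edgeEnds (spoke₁ i w) = outerVertex (proj₁ (ends G i)) , copyVertex i w
  edgeEnds (spoke₂ i w) = outerVertex (proj₂ (ends G i)) , copyVertex i w

  ends-decode : ∀ y → coronaEnds G H y ≡ edgeEnds (decodeEdge y)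
  ends-decode y with splitAt (E G) y
  ... | inj₁ g = refl
  ... | inj₂ r with quotRem {E G} (E H + (V H + V H)) r
  ...   | t , i with splitAt (E H) t
  ...     | inj₁ h = refl
  ...     | inj₂ s with splitAt (V H) s
  ...       | inj₁ w = refl
  ...       | inj₂ w = refl

  ends-⟦⟧ᵉ : ∀ a → coronaEnds G H ⟦ a ⟧ᵉ ≡ edgeEnds a
  ends-⟦⟧ᵉ a = trans (ends-decode ⟦ a ⟧ᵉ) (cong edgeEnds (decode-⟦⟧ᵉ a))

  touches : CoronaVertex → CoronaEdge → Bool
  touches (outer u)  (base g)     = incident G u g
  touches (outer u)  (inner i h)  = false
  touches (outer u)  (spoke₁ i w) = ⌊ proj₁ (ends G i) ≟ u ⌋
  touches (outer u)  (spoke₂ i w) = ⌊ proj₂ (ends G i) ≟ u ⌋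
  touches (copy j v) (base g)     = false
  touches (copy j v) (inner i h)  = ⌊ i ≟ j ⌋ ∧ incident H v h
  touches (copy j v) (spoke₁ i w) = ⌊ i ≟ j ⌋ ∧ ⌊ w ≟ v ⌋
  touches (copy j v) (spoke₂ i w) = ⌊ i ≟ j ⌋ ∧ ⌊ w ≟ v ⌋

  private
    ↑ˡ≢↑ʳ : ∀ {m n} (u : Fin m) (r : Fin n) → u ↑ˡ n ≢ m ↑ʳ r
    ↑ˡ≢↑ʳ {m} {n} u r eq
      with () ← trans (sym (Finₚ.splitAt-↑ˡ m u n)) (trans (cong (splitAt m) eq) (Finₚ.splitAt-↑ʳ m n r))

    ≟-outer : ∀ u u′ → ⌊ outerVertex u ≟ outerVertex u′ ⌋ ≡ ⌊ u ≟ u′ ⌋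
    ≟-outer = ≟-injective outerVertex (Finₚ.↑ˡ-injective _ _ _)

    ≟-outer-copy : ∀ u i w → ⌊ outerVertex u ≟ copyVertex i w ⌋ ≡ false
    ≟-outer-copy u i w = ≟-≢ (λ eq → ↑ˡ≢↑ʳ u (combine i w) eq)

    ≟-copy-outer : ∀ u i w → ⌊ copyVertex i w ≟ outerVertex u ⌋ ≡ false
    ≟-copy-outer u i w = ≟-≢ (λ eq → ↑ˡ≢↑ʳ u (combine i w) (sym eq))

    copyVertex-injective : ∀ {i x j w} → copyVertex i x ≡ copyVertex j w → i ≡ j × x ≡ w
    copyVertex-injective {i} {x} {j} {w} eq = Finₚ.combine-injective i x j w (Finₚ.↑ʳ-injective _ _ _ eq)

    ≟-copy : ∀ i x j w → ⌊ copyVertex i x ≟ copyVertex j w ⌋ ≡ ⌊ i ≟ j ⌋ ∧ ⌊ x ≟ w ⌋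
    ≟-copy i x j w with i ≟ j
    ... | yes refl = ≟-injective (copyVertex i) (λ eq → proj₂ (copyVertex-injective eq)) x w
    ... | no i≢j   = ≟-≢ (λ eq → i≢j (proj₁ (copyVertex-injective eq)))

  incident-⟦⟧ : ∀ v a → incident (G ◇ H) ⟦ v ⟧ᵛ ⟦ a ⟧ᵉ ≡ touches v a
  incident-⟦⟧ v a rewrite ends-⟦⟧ᵉ a = go v a
    where
    go : ∀ v a → ⌊ proj₁ (edgeEnds a) ≟ ⟦ v ⟧ᵛ ⌋ ∨ ⌊ proj₂ (edgeEnds a) ≟ ⟦ v ⟧ᵛ ⌋ ≡ touches v a
    go (outer u)  (base g)     = cong₂ _∨_ (≟-outer (proj₁ (ends G g)) u) (≟-outer (proj₂ (ends G g)) u)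
    go (outer u)  (inner i h)  =
      cong₂ _∨_ (≟-copy-outer u i (proj₁ (ends H h))) (≟-copy-outer u i (proj₂ (ends H h)))
    go (outer u)  (spoke₁ i w) =
      trans (cong₂ _∨_ (≟-outer (proj₁ (ends G i)) u) (≟-copy-outer u i w)) (∨-identityʳ _)
    go (outer u)  (spoke₂ i w) =
      trans (cong₂ _∨_ (≟-outer (proj₂ (ends G i)) u) (≟-copy-outer u i w)) (∨-identityʳ _)
    go (copy j v) (base g)     =
      cong₂ _∨_ (≟-outer-copy (proj₁ (ends G g)) j v) (≟-outer-copy (proj₂ (ends G g)) j v)
    go (copy j v) (inner i h)  =
      trans (cong₂ _∨_ (≟-copy i (proj₁ (ends H h)) j v) (≟-copy i (proj₂ (ends H h)) j v))
            (sym (∧-distribˡ-∨ ⌊ i ≟ j ⌋ _ _))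
    go (copy j v) (spoke₁ i w) = cong₂ _∨_ (≟-outer-copy (proj₁ (ends G i)) j v) (≟-copy i w j v)
    go (copy j v) (spoke₂ i w) = cong₂ _∨_ (≟-outer-copy (proj₂ (ends G i)) j v) (≟-copy i w j v)

  injective-via-⟦⟧ᵛ : {A : Set} (f : Fin (V (G ◇ H)) → A) →
                      Injective _≡_ _≡_ (λ v → f ⟦ v ⟧ᵛ) → Injective _≡_ _≡_ f
  injective-via-⟦⟧ᵛ f f∘⟦⟧-inj {v} {v′} fv≡fv′ = begin
    v                       ≡⟨ ⟦⟧ᵛ-decode v ⟨
    ⟦ decodeVertex v ⟧ᵛ     ≡⟨ cong ⟦_⟧ᵛ (f∘⟦⟧-inj {decodeVertex v} {decodeVertex v′} f⟦⟧≡) ⟩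
    ⟦ decodeVertex v′ ⟧ᵛ    ≡⟨ ⟦⟧ᵛ-decode v′ ⟩
    v′                      ∎
    where
    open ≡-Reasoning
    f⟦⟧≡ : f ⟦ decodeVertex v ⟧ᵛ ≡ f ⟦ decodeVertex v′ ⟧ᵛ
    f⟦⟧≡ = trans (cong f (⟦⟧ᵛ-decode v)) (trans fv≡fv′ (sym (cong f (⟦⟧ᵛ-decode v′))))

  ∑ᶜ : (CoronaEdge → ℕ) → ℕ
  ∑ᶜ f = ∑[ g < E G ] f (base g)
       + ∑[ i < E G ] (∑[ h < E H ] f (inner i h) + (∑[ w < V H ] f (spoke₁ i w) + ∑[ w < V H ] f (spoke₂ i w)))

  ∑-⟦⟧ᵉ : (f : Fin (E (G ◇ H)) → ℕ) → ∑[ y < E (G ◇ H) ] f y ≡ ∑ᶜ (λ a → f ⟦ a ⟧ᵉ)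
  ∑-⟦⟧ᵉ f = begin
    ∑[ y < E (G ◇ H) ] f y
      ≡⟨ ∑-↑ (E G) _ f ⟩
    ∑[ g < E G ] f ⟦ base g ⟧ᵉ + ∑[ r < E G * B ] f (E G ↑ʳ r)
      ≡⟨ cong (∑[ g < E G ] f ⟦ base g ⟧ᵉ +_) (∑-combine (E G) B (λ r → f (E G ↑ʳ r))) ⟩
    ∑[ g < E G ] f ⟦ base g ⟧ᵉ + ∑[ i < E G ] ∑[ t < B ] f (E G ↑ʳ combine i t)
      ≡⟨ cong (∑[ g < E G ] f ⟦ base g ⟧ᵉ +_) (sum-cong-≗ block) ⟩
    ∑ᶜ (λ a → f ⟦ a ⟧ᵉ)
      ∎
    where
    open ≡-Reasoning
    B : ℕ
    B = E H + (V H + V H)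
    block : ∀ i → ∑[ t < B ] f (E G ↑ʳ combine i t)
                ≡ ∑[ h < E H ] f ⟦ inner i h ⟧ᵉ
                  + (∑[ w < V H ] f ⟦ spoke₁ i w ⟧ᵉ + ∑[ w < V H ] f ⟦ spoke₂ i w ⟧ᵉ)
    block i = trans (∑-↑ (E H) (V H + V H) _)
                    (cong (∑[ h < E H ] f ⟦ inner i h ⟧ᵉ +_) (∑-↑ (V H) (V H) _))

  ∑ᶜ-cong : {f f′ : CoronaEdge → ℕ} → (∀ a → f a ≡ f′ a) → ∑ᶜ f ≡ ∑ᶜ f′
  ∑ᶜ-cong f≡f′ = cong₂ _+_ (sum-cong-≗ (λ g → f≡f′ (base g)))
    (sum-cong-≗ (λ i → cong₂ _+_ (sum-cong-≗ (λ h → f≡f′ (inner i h)))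
      (cong₂ _+_ (sum-cong-≗ (λ w → f≡f′ (spoke₁ i w))) (sum-cong-≗ (λ w → f≡f′ (spoke₂ i w))))))

  weight-⟦⟧ : ∀ σ v →
              weight (G ◇ H) σ ⟦ v ⟧ᵛ ≡ ∑ᶜ (λ a → if touches v a then label (G ◇ H) σ ⟦ a ⟧ᵉ else 0)
  weight-⟦⟧ σ v = trans (sum-map-allFin term) (trans (∑-⟦⟧ᵉ term)
    (∑ᶜ-cong (λ a → cong (λ b → if b then label (G ◇ H) σ ⟦ a ⟧ᵉ else 0) (incident-⟦⟧ v a))))
    where
    term : Fin (E (G ◇ H)) → ℕ
    term y = if incident (G ◇ H) ⟦ v ⟧ᵛ y then label (G ◇ H) σ y else 0

  ∑ᶜ-copy : ∀ (L : CoronaEdge → ℕ) j v →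
            ∑ᶜ (λ a → if touches (copy j v) a then L a else 0)
            ≡ ∑[ h < E H ] (if incident H v h then L (inner j h) else 0) + (L (spoke₁ j v) + L (spoke₂ j v))
  ∑ᶜ-copy L j v = cong₂ _+_ (∑-0 (E G)) (trans (∑-single block j elsewhere) atCopy)
    where
    block : Fin (E G) → ℕ
    block i = ∑[ h < E H ] (if ⌊ i ≟ j ⌋ ∧ incident H v h then L (inner i h) else 0)
            + (∑[ w < V H ] (if ⌊ i ≟ j ⌋ ∧ ⌊ w ≟ v ⌋ then L (spoke₁ i w) else 0)
             + ∑[ w < V H ] (if ⌊ i ≟ j ⌋ ∧ ⌊ w ≟ v ⌋ then L (spoke₂ i w) else 0))
    elsewhere : ∀ i → i ≢ j → block i ≡ 0
    elsewhere i i≢j rewrite ≟-≢ i≢j = cong₂ _+_ (∑-0 (E H)) (cong₂ _+_ (∑-0 (V H)) (∑-0 (V H)))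
    atCopy : block j ≡ ∑[ h < E H ] (if incident H v h then L (inner j h) else 0)
                       + (L (spoke₁ j v) + L (spoke₂ j v))
    atCopy rewrite ≟-refl j =
      cong (∑[ h < E H ] (if incident H v h then L (inner j h) else 0) +_)
           (cong₂ _+_ (∑-if-≟ (λ w → L (spoke₁ j w)) v) (∑-if-≟ (λ w → L (spoke₂ j w)) v))

  ∑ᶜ-outer : ∀ (L : CoronaEdge → ℕ) u →
             ∑ᶜ (λ a → if touches (outer u) a then L a else 0)
             ≡ ∑[ g < E G ] ((if incident G u g then L (base g) else 0)
                           + ((if ⌊ proj₁ (ends G g) ≟ u ⌋ then ∑[ w < V H ] L (spoke₁ g w) else 0)
                            + (if ⌊ proj₂ (ends G g) ≟ u ⌋ then ∑[ w < V H ] L (spoke₂ g w) else 0)))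
  ∑ᶜ-outer L u = trans (cong (∑[ g < E G ] (if incident G u g then L (base g) else 0) +_) (sum-cong-≗ block))
                       (sym (∑-distrib-+ (λ g → if incident G u g then L (base g) else 0) _))
    where
    block : ∀ i → ∑[ h < E H ] 0
                  + (∑[ w < V H ] (if ⌊ proj₁ (ends G i) ≟ u ⌋ then L (spoke₁ i w) else 0)
                   + ∑[ w < V H ] (if ⌊ proj₂ (ends G i) ≟ u ⌋ then L (spoke₂ i w) else 0))
                ≡ (if ⌊ proj₁ (ends G i) ≟ u ⌋ then ∑[ w < V H ] L (spoke₁ i w) else 0)
                  + (if ⌊ proj₂ (ends G i) ≟ u ⌋ then ∑[ w < V H ] L (spoke₂ i w) else 0)
    block i = cong₂ _+_ (∑-0 (E H))
                    (cong₂ _+_ (∑-if ⌊ proj₁ (ends G i) ≟ u ⌋ (λ w → L (spoke₁ i w)))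
                               (∑-if ⌊ proj₂ (ends G i) ≟ u ⌋ (λ w → L (spoke₂ i w))))

-- The corona of a bistar

module Bistar (x n : ℕ) where

  centre₀ centre₁ : Fin (V (bistar x n))
  centre₀ = zero
  centre₁ = suc zero

  leaf : Fin (x + n) → Fin (V (bistar x n))
  leaf j = suc (suc j)

  ends-suc₂ : ∀ j → proj₂ (ends (bistar x n) (suc j)) ≡ leaf j
  ends-suc₂ j with splitAt x j in eq
  ... | inj₁ a = cong (λ j → suc (suc j)) (trans (cong (Fin.join x n) (sym eq)) (Finₚ.join-splitAt x n j))
  ... | inj₂ b = cong (λ j → suc (suc j)) (trans (cong (Fin.join x n) (sym eq)) (Finₚ.join-splitAt x n j))

  ends-suc₁ : ∀ j → proj₁ (ends (bistar x n) (suc j)) ≡ centre₀ ⊎ proj₁ (ends (bistar x n) (suc j)) ≡ centre₁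
  ends-suc₁ j with splitAt x j
  ... | inj₁ _ = inj₁ refl
  ... | inj₂ _ = inj₂ refl

  ends-left : ∀ a → proj₁ (ends (bistar x n) (suc (a ↑ˡ n))) ≡ centre₀
  ends-left a rewrite Finₚ.splitAt-↑ˡ x a n = refl

  ends-right : ∀ b → proj₁ (ends (bistar x n) (suc (x ↑ʳ b))) ≡ centre₁
  ends-right b rewrite Finₚ.splitAt-↑ʳ x n b = refl

  ∑-edges : (f : Fin (E (bistar x n)) → ℕ) →
            ∑[ g < E (bistar x n) ] f g ≡ f zero + (∑[ a < x ] f (suc (a ↑ˡ n)) + ∑[ b < n ] f (suc (x ↑ʳ b)))
  ∑-edges f = cong (f zero +_) (∑-↑ x n (λ j → f (suc j)))

slots-count : ∀ p e m → p * e + (p * m + (p * m + p)) ≡ p + p * (e + (m + m))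
slots-count = solve-∀

copy-weight : ∀ i k e m p h r →
  suc (e * i) * k + h + (suc (p * e + m * i + r) + suc (p * e + p * m + m * i + r))
  ≡ i * (k * e + 2 * m) + (h + 2 * r) + (k + 2 * (p * e) + p * m + 2)
copy-weight = solve-∀

≤-slack : ∀ {a b} s → a + s ≡ b → a ≤ b
≤-slack {a} s eq = subst (a ≤_) eq (m≤m+n a s)

-- Writing m = 1 + k + t, resp. m = 1 + m′ and e = m′ + t, the difference of the two sides is a
-- polynomial with natural coefficients; it is the slack handed to the ring solver.
copies-below-leaves : ∀ p e k m R → k < m →
  p * (k * e + 2 * m) + (k + 2 * (p * e) + p * m + 2)
  ≤ suc (p * e + p * m + p * m + 1) + (m * suc (p * e + p * m + m * 1) + R)
copies-below-leaves p e k m R k<m with m ∸ suc k | m+[n∸m]≡n k<m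
... | t | refl =
  ≤-slack (suc t + t * p * e + p * suc (k + t) * (k + t) + suc (k + t) * suc (k + t) + R)
          (solve (p ∷ e ∷ k ∷ t ∷ R ∷ []))

leaves-below-centre : ∀ s e m R → 1 ≤ m → m ≤ suc e → let p = suc s in
  suc (p * e + p * m + p * m + suc s) + (m * suc (p * e + p * m + m * suc s) + R)
  < suc (p * e + p * m + p * m + 0) + (m * suc (p * e + m * 0) + R)
    + 2 * (suc (p * e + p * m + p * m + 1) + (m * suc (p * e + m * 1) + R))
leaves-below-centre s e (suc m′) R _ (s≤s m′≤e) with e ∸ m′ | m+[n∸m]≡n m′≤e
... | t | refl =
  ≤-slack (4 + s + 2 * suc s * t * (m′ + 2) + 4 * suc s * m′ + 2 * suc m′ + 2 * suc m′ * suc m′ + 2 * R)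
          (solve (s ∷ m′ ∷ t ∷ R ∷ []))

module Labelling (x n : ℕ) (H : Graph) where

  open Corona (bistar x n) H public

  p e m : ℕ
  p = suc (x + n)
  e = E H
  m = V H

  Hsum : Fin m → ℕ
  Hsum w = ∑[ h < e ] (if incident H w h then toℕ h else 0)

  open Ranking Hsum public using (rank; rank<; ranking; toℕ-ranking; +2*rank-injective)

  -- The label blocks, in increasing order.
  Slot : Set
  Slot = Fin p × Fin e ⊎ (Fin p × Fin m ⊎ (Fin p × Fin m ⊎ Fin p))

  slotIndex : Fin (p * e + (p * m + (p * m + p))) ↔ Slot
  slotIndex =
    (*↔× ⊎-↔ (*↔× ⊎-↔ (*↔× ⊎-↔ ↔-id _))) ↔-∘ ((↔-id _ ⊎-↔ ((↔-id _ ⊎-↔ +↔⊎) ↔-∘ +↔⊎)) ↔-∘ +↔⊎)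

  assign : CoronaEdge ↔ Slot
  assign = mk↔ₛ′ slot edge slot∘edge edge∘slot
    where
    slot : CoronaEdge → Slot
    slot (base g)     = inj₂ (inj₂ (inj₂ g))
    slot (inner i h)  = inj₁ (i , h)
    slot (spoke₁ i w) = inj₂ (inj₁ (i , ranking ⟨$⟩ʳ w))
    slot (spoke₂ i w) = inj₂ (inj₂ (inj₁ (i , ranking ⟨$⟩ʳ w)))
    edge : Slot → CoronaEdge
    edge (inj₁ (i , h))               = inner i h
    edge (inj₂ (inj₁ (i , r)))        = spoke₁ i (ranking ⟨$⟩ˡ r)
    edge (inj₂ (inj₂ (inj₁ (i , r)))) = spoke₂ i (ranking ⟨$⟩ˡ r)
    edge (inj₂ (inj₂ (inj₂ g)))       = base g
    slot∘edge : ∀ s → slot (edge s) ≡ s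
    slot∘edge (inj₁ (i , h))               = refl
    slot∘edge (inj₂ (inj₁ (i , r)))        = cong (λ r → inj₂ (inj₁ (i , r))) (inverseʳ ranking)
    slot∘edge (inj₂ (inj₂ (inj₁ (i , r)))) = cong (λ r → inj₂ (inj₂ (inj₁ (i , r)))) (inverseʳ ranking)
    slot∘edge (inj₂ (inj₂ (inj₂ g)))       = refl
    edge∘slot : ∀ a → edge (slot a) ≡ a
    edge∘slot (base g)     = refl
    edge∘slot (inner i h)  = refl
    edge∘slot (spoke₁ i w) = cong (spoke₁ i) (inverseˡ ranking)
    edge∘slot (spoke₂ i w) = cong (spoke₂ i) (inverseˡ ranking)

  labelling : Permutation′ (E (bistar x n ◇ H))
  labelling = cast-id slots≡edges ↔-∘ (↔-sym slotIndex ↔-∘ (assign ↔-∘ edgeIndex))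
    where
    slots≡edges : p * e + (p * m + (p * m + p)) ≡ p + p * (e + (m + m))
    slots≡edges = slots-count p e m

  labelValue : CoronaEdge → ℕ
  labelValue (inner i h)  = e * toℕ i + toℕ h
  labelValue (spoke₁ i w) = p * e + m * toℕ i + rank w
  labelValue (spoke₂ i w) = p * e + p * m + m * toℕ i + rank w
  labelValue (base g)     = p * e + p * m + p * m + toℕ g

  label-⟦⟧ : ∀ a → label (bistar x n ◇ H) labelling ⟦ a ⟧ᵉ ≡ suc (labelValue a)
  label-⟦⟧ a = cong suc (trans (toℕ-cast _ _) (trans (cong position (decode-⟦⟧ᵉ a)) (toℕ-position a)))
    where
    open ≡-Reasoning
    position : CoronaEdge → ℕ
    position a = toℕ (Inverse.from slotIndex (Inverse.to assign a))
    spoke : ∀ {o} (i : Fin p) w → toℕ (combine i (ranking ⟨$⟩ʳ w) ↑ˡ o) ≡ m * toℕ i + rank w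
    spoke {o} i w = trans (toℕ-↑ˡ (combine i (ranking ⟨$⟩ʳ w)) o)
                          (trans (toℕ-combine i _) (cong (m * toℕ i +_) (toℕ-ranking w)))
    toℕ-position : ∀ a → position a ≡ labelValue a
    toℕ-position (inner i h)  = trans (toℕ-↑ˡ (combine i h) _) (toℕ-combine i h)
    toℕ-position (spoke₁ i w) = trans (toℕ-↑ʳ (p * e) _) $ begin
      p * e + toℕ (combine i (ranking ⟨$⟩ʳ w) ↑ˡ _)         ≡⟨ cong (p * e +_) (spoke i w) ⟩
      p * e + (m * toℕ i + rank w)                          ≡⟨ +-assoc (p * e) _ _ ⟨
      p * e + m * toℕ i + rank w                            ∎
    toℕ-position (spoke₂ i w) = trans (toℕ-↑ʳ (p * e) _) $ begin
      p * e + toℕ (p * m ↑ʳ (combine i (ranking ⟨$⟩ʳ w) ↑ˡ p)) ≡⟨ cong (p * e +_) (toℕ-↑ʳ (p * m) _) ⟩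
      p * e + (p * m + toℕ (combine i (ranking ⟨$⟩ʳ w) ↑ˡ p)) ≡⟨ cong (λ s → p * e + (p * m + s)) (spoke i w) ⟩
      p * e + (p * m + (m * toℕ i + rank w))                  ≡⟨ +-assoc (p * e) (p * m) _ ⟨
      p * e + p * m + (m * toℕ i + rank w)                    ≡⟨ +-assoc (p * e + p * m) _ _ ⟨
      p * e + p * m + m * toℕ i + rank w                      ∎
    toℕ-position (base g) = trans (toℕ-↑ʳ (p * e) _) $ begin
      p * e + toℕ (p * m ↑ʳ (p * m ↑ʳ g))                    ≡⟨ cong (p * e +_) (toℕ-↑ʳ (p * m) _) ⟩
      p * e + (p * m + toℕ (p * m ↑ʳ g))                     ≡⟨ cong (λ s → p * e + (p * m + s)) (toℕ-↑ʳ (p * m) g) ⟩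
      p * e + (p * m + (p * m + toℕ g))                      ≡⟨ +-assoc (p * e) (p * m) _ ⟨
      p * e + p * m + (p * m + toℕ g)                        ≡⟨ +-assoc (p * e + p * m) _ _ ⟨
      p * e + p * m + p * m + toℕ g                          ∎

  weightAt : CoronaVertex → ℕ
  weightAt v = weight (bistar x n ◇ H) labelling ⟦ v ⟧ᵛ

  weightAt-∑ᶜ : ∀ v → weightAt v ≡ ∑ᶜ (λ a → if touches v a then suc (labelValue a) else 0)
  weightAt-∑ᶜ v = trans (weight-⟦⟧ labelling v)
                        (∑ᶜ-cong (λ a → cong (λ l → if touches v a then l else 0) (label-⟦⟧ a)))

  R : ℕ
  R = ∑[ w < m ] rank w

  ∑-+rank : ∀ c → ∑[ w < m ] (c + rank w) ≡ m * c + R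
  ∑-+rank c = trans (∑-distrib-+ (λ _ → c) rank) (cong (_+ R) (∑-const m c))

  bistarLabel spokes₁ spokes₂ : ℕ → ℕ
  bistarLabel t = suc (p * e + p * m + p * m + t)
  spokes₁ t     = m * suc (p * e + m * t) + R
  spokes₂ t     = m * suc (p * e + p * m + m * t) + R

  share : Fin (V (bistar x n)) → Fin p → ℕ
  share u g = (if incident (bistar x n) u g then bistarLabel (toℕ g) else 0)
                   + ((if ⌊ proj₁ (ends (bistar x n) g) ≟ u ⌋ then spokes₁ (toℕ g) else 0)
                    + (if ⌊ proj₂ (ends (bistar x n) g) ≟ u ⌋ then spokes₂ (toℕ g) else 0))

  weightAt-outer : ∀ u → weightAt (outer u) ≡ ∑[ g < p ] share u g
  weightAt-outer u = trans (weightAt-∑ᶜ (outer u)) (trans (∑ᶜ-outer (suc ∘′ labelValue) u) (sum-cong-≗ spokeSums))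
    where
    if-cong : ∀ b {s t} → s ≡ t → (if b then s else 0) ≡ (if b then t else 0)
    if-cong b = cong (λ s → if b then s else 0)
    spokeSums : ∀ g → (if incident (bistar x n) u g then bistarLabel (toℕ g) else 0)
                      + ((if ⌊ proj₁ (ends (bistar x n) g) ≟ u ⌋ then ∑[ w < m ] suc (labelValue (spoke₁ g w)) else 0)
                       + (if ⌊ proj₂ (ends (bistar x n) g) ≟ u ⌋ then ∑[ w < m ] suc (labelValue (spoke₂ g w)) else 0))
                      ≡ share u g
    spokeSums g = cong ((if incident (bistar x n) u g then bistarLabel (toℕ g) else 0) +_)
      (cong₂ _+_ (if-cong ⌊ proj₁ (ends (bistar x n) g) ≟ u ⌋ (∑-+rank (suc (p * e + m * toℕ g))))
                 (if-cong ⌊ proj₂ (ends (bistar x n) g) ≟ u ⌋ (∑-+rank (suc (p * e + p * m + m * toℕ g)))))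

  open Bistar x n

  firstEndShare leafWeight : ℕ → ℕ
  firstEndShare t = bistarLabel t + spokes₁ t
  leafWeight t = bistarLabel (suc t) + spokes₂ (suc t)

  weightAt-leaf : ∀ j → weightAt (outer (leaf j)) ≡ leafWeight (toℕ j)
  weightAt-leaf j = trans (weightAt-outer (leaf j)) (trans (∑-single (share (leaf j)) (suc j) elsewhere) here)
    where
    here : share (leaf j) (suc j) ≡ leafWeight (toℕ j)
    here rewrite ends-suc₂ j | ≟-refl (leaf j) with ends-suc₁ j
    ... | inj₁ centre rewrite centre = refl
    ... | inj₂ centre rewrite centre = refl
    leaf-injective : ∀ {j′} → suc j′ ≢ suc j → leaf j′ ≢ leaf j
    leaf-injective j′≢j eq = j′≢j (Finₚ.suc-injective eq)
    elsewhere : ∀ g → g ≢ suc j → share (leaf j) g ≡ 0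
    elsewhere zero     _     = refl
    elsewhere (suc j′) j′≢j
      rewrite ends-suc₂ j′ | ≟-≢ (leaf-injective j′≢j)
      with ends-suc₁ j′
    ... | inj₁ centre rewrite centre = refl
    ... | inj₂ centre rewrite centre = refl

  weightAt-centre₀ : weightAt (outer centre₀) ≡ firstEndShare 0 + ∑[ a < x ] firstEndShare (suc (toℕ a))
  weightAt-centre₀ = begin
    weightAt (outer centre₀)
      ≡⟨ trans (weightAt-outer centre₀) (∑-edges (share centre₀)) ⟩
    share centre₀ zero + (∑[ a < x ] share centre₀ (suc (a ↑ˡ n)) + ∑[ b < n ] share centre₀ (suc (x ↑ʳ b)))
      ≡⟨ cong₂ _+_ (cong (bistarLabel 0 +_) (+-identityʳ (spokes₁ 0)))
                   (cong₂ _+_ (sum-cong-≗ first) (∑-≡0 (λ b → share centre₀ (suc (x ↑ʳ b))) second)) ⟩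
    firstEndShare 0 + (∑[ a < x ] firstEndShare (suc (toℕ a)) + 0)
      ≡⟨ cong (firstEndShare 0 +_) (+-identityʳ _) ⟩
    firstEndShare 0 + ∑[ a < x ] firstEndShare (suc (toℕ a))
      ∎
    where
    open ≡-Reasoning
    first : ∀ a → share centre₀ (suc (a ↑ˡ n)) ≡ firstEndShare (suc (toℕ a))
    first a rewrite ends-left a | ends-suc₂ (a ↑ˡ n) | toℕ-↑ˡ a n =
      cong (bistarLabel (suc (toℕ a)) +_) (+-identityʳ (spokes₁ (suc (toℕ a))))
    second : ∀ b → share centre₀ (suc (x ↑ʳ b)) ≡ 0
    second b rewrite ends-right b | ends-suc₂ (x ↑ʳ b) = refl

  weightAt-centre₁ : weightAt (outer centre₁) ≡ bistarLabel 0 + spokes₂ 0 + ∑[ b < n ] firstEndShare (suc (x + toℕ b))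
  weightAt-centre₁ = begin
    weightAt (outer centre₁)
      ≡⟨ trans (weightAt-outer centre₁) (∑-edges (share centre₁)) ⟩
    share centre₁ zero + (∑[ a < x ] share centre₁ (suc (a ↑ˡ n)) + ∑[ b < n ] share centre₁ (suc (x ↑ʳ b)))
      ≡⟨ cong (bistarLabel 0 + spokes₂ 0 +_)
              (cong₂ _+_ (∑-≡0 (λ a → share centre₁ (suc (a ↑ˡ n))) first) (sum-cong-≗ second)) ⟩
    bistarLabel 0 + spokes₂ 0 + ∑[ b < n ] firstEndShare (suc (x + toℕ b))
      ∎
    where
    open ≡-Reasoning
    first : ∀ a → share centre₁ (suc (a ↑ˡ n)) ≡ 0
    first a rewrite ends-left a | ends-suc₂ (a ↑ˡ n) = refl
    second : ∀ b → share centre₁ (suc (x ↑ʳ b)) ≡ firstEndShare (suc (x + toℕ b))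
    second b rewrite ends-right b | ends-suc₂ (x ↑ʳ b) | toℕ-↑ʳ x b =
      cong (bistarLabel (suc (x + toℕ b)) +_) (+-identityʳ (spokes₁ (suc (x + toℕ b))))

  firstEndShare-mono-≤ : ∀ {t t′} → t ≤ t′ → firstEndShare t ≤ firstEndShare t′
  firstEndShare-mono-≤ t≤t′ =
    +-mono-≤ (s≤s (+-monoʳ-≤ (p * e + p * m + p * m) t≤t′))
             (+-monoˡ-≤ R (*-monoʳ-≤ m (s≤s (+-monoʳ-≤ (p * e) (*-monoʳ-≤ m t≤t′)))))

  leafWeight-mono-≤ : ∀ {t t′} → t ≤ t′ → leafWeight t ≤ leafWeight t′
  leafWeight-mono-≤ t≤t′ =
    +-mono-≤ (s≤s (+-monoʳ-≤ (p * e + p * m + p * m) (s≤s t≤t′)))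
             (+-monoˡ-≤ R (*-monoʳ-≤ m (s≤s (+-monoʳ-≤ (p * e + p * m) (*-monoʳ-≤ m (s≤s t≤t′))))))

  leafWeight-mono-< : ∀ {t t′} → t < t′ → leafWeight t < leafWeight t′
  leafWeight-mono-< t<t′ =
    +-mono-<-≤ (s≤s (+-monoʳ-< (p * e + p * m + p * m) (s≤s t<t′)))
               (+-monoˡ-≤ R (*-monoʳ-≤ m (s≤s (+-monoʳ-≤ (p * e + p * m) (*-monoʳ-≤ m (s≤s (<⇒≤ t<t′)))))))

  module _ {k} (regular : Regular k H) (k<m : k < m) (m≤1+e : m ≤ suc e) (2≤x : 2 ≤ x) (x≤n : x ≤ n) where

    D C : ℕ
    D = k * e + 2 * m
    C = k + 2 * (p * e) + p * m + 2

    0<m : 0 < m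
    0<m = ≤-trans (s≤s z≤n) k<m

    degree≡k : ∀ w → ∑[ h < e ] χ (incident H w h) ≡ k
    degree≡k w = trans (sym (Degree.degree-∑ H w)) (regular w)

    weightAt-copy : ∀ i w → weightAt (copy i w) ≡ toℕ i * D + (Hsum w + 2 * rank w) + C
    weightAt-copy i w = begin
      weightAt (copy i w)
        ≡⟨ trans (weightAt-∑ᶜ (copy i w)) (∑ᶜ-copy (suc ∘′ labelValue) i w) ⟩
      ∑[ h < e ] (if incident H w h then suc (e * toℕ i) + toℕ h else 0) + spokes
        ≡⟨ cong (_+ spokes) (∑-if-+ (λ h → incident H w h) (suc (e * toℕ i)) toℕ) ⟩
      suc (e * toℕ i) * ∑[ h < e ] χ (incident H w h) + Hsum w + spokes
        ≡⟨ cong (λ d → suc (e * toℕ i) * d + Hsum w + spokes) (degree≡k w) ⟩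
      suc (e * toℕ i) * k + Hsum w + spokes
        ≡⟨ copy-weight (toℕ i) k e m p (Hsum w) (rank w) ⟩
      toℕ i * D + (Hsum w + 2 * rank w) + C
        ∎
      where
      open ≡-Reasoning
      spokes : ℕ
      spokes = suc (labelValue (spoke₁ i w)) + suc (labelValue (spoke₂ i w))

    Hsum+2*rank<D : ∀ w → Hsum w + 2 * rank w < D
    Hsum+2*rank<D w = +-mono-≤-< Hsum≤ke (*-monoʳ-< 2 (rank< w))
      where
      if-≤ : ∀ b {c d} → c ≤ d → (if b then c else 0) ≤ (if b then d else 0)
      if-≤ true  c≤d = c≤d
      if-≤ false _   = z≤n
      Hsum≤ke : Hsum w ≤ k * e
      Hsum≤ke = begin
        Hsum w                                         ≤⟨ ∑-mono-≤ (λ h → if-≤ (incident H w h) (<⇒≤ (toℕ<n h))) ⟩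
        ∑[ h < e ] (if incident H w h then e else 0)   ≡⟨ ∑-if-const (λ h → incident H w h) e ⟩
        e * ∑[ h < e ] χ (incident H w h)              ≡⟨ cong (e *_) (degree≡k w) ⟩
        e * k                                          ≡⟨ *-comm e k ⟩
        k * e                                          ∎
        where open ≤-Reasoning

    copy<leafWeight₀ : ∀ i w → weightAt (copy i w) < leafWeight 0
    copy<leafWeight₀ i w = begin-strict
      weightAt (copy i w)                               ≡⟨ weightAt-copy i w ⟩
      toℕ i * D + (Hsum w + 2 * rank w) + C      <⟨ +-monoˡ-< C (+-monoʳ-< (toℕ i * D) (Hsum+2*rank<D w)) ⟩
      toℕ i * D + D + C                          ≡⟨ cong (_+ C) (+-comm (toℕ i * D) D) ⟩
      suc (toℕ i) * D + C                        ≤⟨ +-monoˡ-≤ C (*-monoˡ-≤ D (toℕ<n i)) ⟩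
      p * D + C                                  ≤⟨ copies-below-leaves p e k m R k<m ⟩
      leafWeight 0                               ∎
      where open ≤-Reasoning

    leafWeight<centre₀ : leafWeight (x + n) < weightAt (outer centre₀)
    leafWeight<centre₀ = begin-strict
      leafWeight (x + n)
        <⟨ leaves-below-centre (x + n) e m R 0<m m≤1+e ⟩
      firstEndShare 0 + 2 * firstEndShare 1
        ≤⟨ +-monoʳ-≤ (firstEndShare 0) (*-monoˡ-≤ (firstEndShare 1) 2≤x) ⟩
      firstEndShare 0 + x * firstEndShare 1
        ≡⟨ cong (firstEndShare 0 +_) (∑-const x (firstEndShare 1)) ⟨
      firstEndShare 0 + ∑[ a < x ] firstEndShare 1
        ≤⟨ +-monoʳ-≤ (firstEndShare 0) (∑-mono-≤ {n = x} (λ a → firstEndShare-mono-≤ (s≤s (z≤n {toℕ a})))) ⟩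
      firstEndShare 0 + ∑[ a < x ] firstEndShare (suc (toℕ a))
        ≡⟨ weightAt-centre₀ ⟨
      weightAt (outer centre₀)
        ∎
      where open ≤-Reasoning

    centre₀<centre₁ : weightAt (outer centre₀) < weightAt (outer centre₁)
    centre₀<centre₁ = begin-strict
      weightAt (outer centre₀)
        ≡⟨ weightAt-centre₀ ⟩
      firstEndShare 0 + ∑[ a < x ] firstEndShare (suc (toℕ a))
        ≤⟨ +-monoʳ-≤ (firstEndShare 0) (∑-mono-≤ {n = x} (λ a → firstEndShare-mono-≤ (toℕ<n a))) ⟩
      firstEndShare 0 + ∑[ a < x ] firstEndShare x
        ≡⟨ cong (firstEndShare 0 +_) (∑-const x (firstEndShare x)) ⟩
      firstEndShare 0 + x * firstEndShare x
        <⟨ +-mono-<-≤ (+-monoʳ-< (bistarLabel 0) spokes₁<spokes₂) (*-mono-≤ x≤n (firstEndShare-mono-≤ (n≤1+n x))) ⟩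
      bistarLabel 0 + spokes₂ 0 + n * firstEndShare (suc x)
        ≡⟨ cong (bistarLabel 0 + spokes₂ 0 +_) (∑-const n (firstEndShare (suc x))) ⟨
      bistarLabel 0 + spokes₂ 0 + ∑[ b < n ] firstEndShare (suc x)
        ≤⟨ +-monoʳ-≤ (bistarLabel 0 + spokes₂ 0)
                     (∑-mono-≤ {n = n} (λ b → firstEndShare-mono-≤ (s≤s (m≤m+n x (toℕ b))))) ⟩
      bistarLabel 0 + spokes₂ 0 + ∑[ b < n ] firstEndShare (suc (x + toℕ b))
        ≡⟨ weightAt-centre₁ ⟨
      weightAt (outer centre₁)
        ∎
      where
      open ≤-Reasoning
      instance
        m≢0 : ℕ.NonZero m
        m≢0 = ℕ.>-nonZero 0<m
      spokes₁<spokes₂ : spokes₁ 0 < spokes₂ 0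
      spokes₁<spokes₂ =
        +-monoˡ-< R (*-monoʳ-< m (s≤s (+-monoˡ-< (m * 0) (m<m+n (p * e) (≤-trans 0<m (m≤n*m m p))))))

    leaf<centre₀ : ∀ j → weightAt (outer (leaf j)) < weightAt (outer centre₀)
    leaf<centre₀ j =
      ≤-<-trans (≤-trans (≤-reflexive (weightAt-leaf j)) (leafWeight-mono-≤ (<⇒≤ (toℕ<n j)))) leafWeight<centre₀

    leaf<centre₁ : ∀ j → weightAt (outer (leaf j)) < weightAt (outer centre₁)
    leaf<centre₁ j = <-trans (leaf<centre₀ j) centre₀<centre₁

    leafWeight₀≤outer : ∀ u → leafWeight 0 ≤ weightAt (outer u)
    leafWeight₀≤outer zero          = <⇒≤ (≤-<-trans (leafWeight-mono-≤ z≤n) leafWeight<centre₀)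
    leafWeight₀≤outer (suc zero)    = <⇒≤ (<-trans (≤-<-trans (leafWeight-mono-≤ z≤n) leafWeight<centre₀) centre₀<centre₁)
    leafWeight₀≤outer (suc (suc j)) = ≤-trans (leafWeight-mono-≤ z≤n) (≤-reflexive (sym (weightAt-leaf j)))

    weightAt-outer-injective : ∀ {u u′} → weightAt (outer u) ≡ weightAt (outer u′) → u ≡ u′
    weightAt-outer-injective {zero}        {zero}         _  = refl
    weightAt-outer-injective {zero}        {suc zero}     eq = contradiction eq (<⇒≢ centre₀<centre₁)
    weightAt-outer-injective {zero}        {suc (suc j)}  eq = contradiction eq (>⇒≢ (leaf<centre₀ j))
    weightAt-outer-injective {suc zero}    {zero}         eq = contradiction eq (>⇒≢ centre₀<centre₁)
    weightAt-outer-injective {suc zero}    {suc zero}     _  = refl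
    weightAt-outer-injective {suc zero}    {suc (suc j)}  eq = contradiction eq (>⇒≢ (leaf<centre₁ j))
    weightAt-outer-injective {suc (suc j)} {zero}         eq = contradiction eq (<⇒≢ (leaf<centre₀ j))
    weightAt-outer-injective {suc (suc j)} {suc zero}     eq = contradiction eq (<⇒≢ (leaf<centre₁ j))
    weightAt-outer-injective {suc (suc j)} {suc (suc j′)} eq =
      cong leaf (toℕ-injective (leafWeight-injective (trans (sym (weightAt-leaf j)) (trans eq (weightAt-leaf j′)))))
      where
      leafWeight-injective : Injective _≡_ _≡_ leafWeight
      leafWeight-injective = strictlyFollows⇒injective (λ t → t) leafWeight (λ eq → eq) leafWeight-mono-<

    weightAt-copy-injective : ∀ {i i′ w w′} → weightAt (copy i w) ≡ weightAt (copy i′ w′) → i ≡ i′ × w ≡ w′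
    weightAt-copy-injective {i} {i′} {w} {w′} eq =
      toℕ-injective (proj₁ split) , +2*rank-injective {w} {w′} (proj₂ split)
      where
      split : toℕ i ≡ toℕ i′ × Hsum w + 2 * rank w ≡ Hsum w′ + 2 * rank w′
      split = *+-injective D (toℕ i) (toℕ i′) (Hsum+2*rank<D w) (Hsum+2*rank<D w′)
                (+-cancelʳ-≡ C (toℕ i * D + (Hsum w + 2 * rank w)) (toℕ i′ * D + (Hsum w′ + 2 * rank w′))
                   (trans (sym (weightAt-copy i w)) (trans eq (weightAt-copy i′ w′))))

    weightAt-injective : Injective _≡_ _≡_ weightAt
    weightAt-injective {outer u}  {outer u′}  eq = cong outer (weightAt-outer-injective eq)
    weightAt-injective {copy i w} {copy i′ w′} eq =
      cong₂ (λ i w → copy i w) (proj₁ same) (proj₂ same)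
      where
      same : i ≡ i′ × w ≡ w′
      same = weightAt-copy-injective {i} {i′} {w} {w′} eq
    weightAt-injective {copy i w} {outer u}   eq =
      contradiction eq (<⇒≢ (<-≤-trans (copy<leafWeight₀ i w) (leafWeight₀≤outer u)))
    weightAt-injective {outer u}  {copy i w}  eq =
      contradiction eq (>⇒≢ (<-≤-trans (copy<leafWeight₀ i w) (leafWeight₀≤outer u)))

    antimagic : Antimagic (bistar x n ◇ H)
    antimagic = labelling , injective-via-⟦⟧ᵛ (weight (bistar x n ◇ H) labelling) weightAt-injective

theorem3p2 : (x n k m : ℕ) → 2 ≤ x → x ≤ n → (H : Graph) → Simple H → Connected H
           → Regular k H → V H ≡ m → 2 ≤ m → Antimagic (bistar x n ◇ H)
theorem3p2 x n k _ 2≤x x≤n H simple connected regular refl 2≤m =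
  Labelling.antimagic x n H regular (k<V simple) V≤1+E 2≤x x≤n
  where open RegularGraph H connected regular 2≤m
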